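{- Let $x,n,m,a,b,c$ be positive integers with $m\geq 2$ and $\varphi(ax^m)=\frac{b\cdot n!}{c}$, and let $p$ be a prime with $p>a$, $p>b$, $p>c$. If $p\mid x$, then $p\leq n$. Conversely, if $p\leq n$ and $p\nmid x$, then $p=2$ and $n\in\{3,5,7\}$.
   Context: $\varphi$ denotes Euler's totient function. -}

module Defs where

open import Data.Nat using (ℕ; suc; _≟_)
open import Data.Nat.GCD using (gcd)
open import Data.List using (length; filter; upTo; map)
open import Relation.Nullary.Decidable using (does)
open import Relation.Nullary using (Dec)

-- Euler's totient: φ n = #{ k ∈ {1,…,n} : gcd k n = 1 }  (so φ 0 = 0, φ 1 = 1)
φ : ℕ → ℕ
φ n = length (filter (λ k → gcd k n ≟ 1) (map suc (upTo n)))

-- Part one: p ∣ x gives p² ∣ a xᵐ, hence p ∣ φ(a xᵐ) (φ(r M) = r φ(M) when r ∣ M), hence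
-- p ∣ b n!, and p ∤ b, so p ∣ n! and p ≤ n.
--
-- Part two: write N = a xᵐ, so p ∤ N, and every prime factor of N is at most n (those of a are
-- below p, those of x are below p or bounded by part one).
-- For such N one has φ(N) ∣ N · ∏_{q ≤ n prime} (q - 1) (by induction on the bound, peeling off
-- the largest prime with φ(r M) = r φ(M) for r ∣ M and φ(r M) = (r - 1) φ(M) for r ∤ M).
-- Comparing with c φ(N) = b n! shows that n! cannot contain ∏_{q ≤ n prime} (q - 1) · p, since
-- otherwise p ∣ c N. Finally n! does contain that product times p unless p = 2 and n ∈ {3, 5, 7}:
-- an odd p leaves the factor p itself unused (p + 1 is not prime), and for p = 2 the factor 2
-- comes from n when n is even and from the unused factor 8 when n ≥ 8.
module Submission where

open import Defs
open import Data.Bool using (Bool; true; false; _∧_; not; if_then_else_)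
open import Data.Bool.Properties using (∧-zeroʳ; ∧-identityʳ)
open import Data.Empty using (⊥-elim)
open import Data.List using ([]; _∷_; length; filter; applyUpTo)
open import Data.List.Properties using (map-upTo)
open import Data.List.Relation.Unary.All using (_∷_)
open import Data.Nat
open import Data.Nat.Coprimality using (Coprime; coprime?; coprime-divisor; gcd≡1⇒coprime; coprime⇒gcd≡1)
import Data.Nat.Coprimality as Coprimality
open import Data.Nat.Divisibility
open import Data.Nat.DivMod using (_%_; [m+kn]%n≡m%n; m<n⇒m%n≡m)
open import Data.Nat.GCD using (gcd)
open import Data.Nat.Induction using (<-rec)
open import Data.Nat.ListAction using (product)
open import Data.Nat.Primality using (Prime; prime?; euclidsLemma; prime⇒irreducible; prime⇒nonTrivial)
open import Data.Nat.Primality.Factorisation using (factorise)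
open import Data.Nat.Properties
open import Data.Nat.Tactic.RingSolver using (solve-∀)
open import Data.Product using (_×_; _,_)
open import Data.Sum using (_⊎_; inj₁; inj₂)
open import Function using (_∘_)
open import Function.Bundles using (mk⇔)
open import Relation.Nullary using (¬_; does; yes; no)
open import Relation.Nullary.Decidable using (does-⇔; ¬?; _×-dec_; dec-true; dec-false; from-no)
open import Relation.Unary using (Decidable)
open import Relation.Binary.PropositionalEquality

⟦_⟧ : Bool → ℕ
⟦ true ⟧  = 1
⟦ false ⟧ = 0

count : (ℕ → Bool) → ℕ → ℕ → ℕ
count P s zero    = 0
count P s (suc n) = ⟦ P s ⟧ + count P (suc s) n

count-cong : ∀ {P Q} → (∀ i → P i ≡ Q i) → ∀ s n → count P s n ≡ count Q s n
count-cong P≗Q s zero    = refl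
count-cong P≗Q s (suc n) = cong₂ _+_ (cong ⟦_⟧ (P≗Q s)) (count-cong P≗Q (suc s) n)

count-+ : ∀ P s m n → count P s (m + n) ≡ count P s m + count P (s + m) n
count-+ P s zero    n = cong (λ t → count P t n) (sym (+-identityʳ s))
count-+ P s (suc m) n = begin
  ⟦ P s ⟧ + count P (suc s) (m + n)                        ≡⟨ cong (⟦ P s ⟧ +_) (count-+ P (suc s) m n) ⟩
  ⟦ P s ⟧ + (count P (suc s) m + count P (suc s + m) n)     ≡⟨ sym (+-assoc ⟦ P s ⟧ _ _) ⟩
  ⟦ P s ⟧ + count P (suc s) m + count P (suc s + m) n       ≡⟨ cong (λ t → ⟦ P s ⟧ + count P (suc s) m + count P t n) (sym (+-suc s m)) ⟩
  ⟦ P s ⟧ + count P (suc s) m + count P (s + suc m) n       ∎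
  where open ≡-Reasoning

count-shift : ∀ P N s n → count P (s + N) n ≡ count (λ i → P (i + N)) s n
count-shift P N s zero    = refl
count-shift P N s (suc n) = cong (⟦ P (s + N) ⟧ +_) (count-shift P N (suc s) n)

count-periodic : ∀ P N → (∀ i → P (i + N) ≡ P i) → ∀ r s → count P s (r * N) ≡ r * count P s N
count-periodic P N periodic zero    s = refl
count-periodic P N periodic (suc r) s = begin
  count P s (N + r * N)                ≡⟨ count-+ P s N (r * N) ⟩
  count P s N + count P (s + N) (r * N) ≡⟨ cong (count P s N +_) (trans (count-shift P N s (r * N)) (count-cong periodic s (r * N))) ⟩
  count P s N + count P s (r * N)       ≡⟨ cong (count P s N +_) (count-periodic P N periodic r s) ⟩
  count P s N + r * count P s N         ∎
  where open ≡-Reasoning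

count-∧-split : ∀ (P Q : ℕ → Bool) s n → count P s n ≡ count (λ i → P i ∧ Q i) s n + count (λ i → P i ∧ not (Q i)) s n
count-∧-split P Q s zero    = refl
count-∧-split P Q s (suc n) = begin
  ⟦ P s ⟧ + count P (suc s) n                   ≡⟨ cong₂ _+_ (split-point (P s) (Q s)) (count-∧-split P Q (suc s) n) ⟩
  (⟦ P s ∧ Q s ⟧ + ⟦ P s ∧ not (Q s) ⟧) + (A + B) ≡⟨ +-exchange ⟦ P s ∧ Q s ⟧ ⟦ P s ∧ not (Q s) ⟧ A B ⟩
  (⟦ P s ∧ Q s ⟧ + A) + (⟦ P s ∧ not (Q s) ⟧ + B) ∎
  where
  open ≡-Reasoning
  A : ℕ
  A = count (λ i → P i ∧ Q i) (suc s) n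
  B : ℕ
  B = count (λ i → P i ∧ not (Q i)) (suc s) n
  split-point : ∀ x y → ⟦ x ⟧ ≡ ⟦ x ∧ y ⟧ + ⟦ x ∧ not y ⟧
  split-point true  true  = refl
  split-point true  false = refl
  split-point false y     = refl
  +-exchange : ∀ a b c d → (a + b) + (c + d) ≡ (a + c) + (b + d)
  +-exchange = solve-∀

count-none : ∀ P s n → (∀ k → k < n → P (k + s) ≡ false) → count P s n ≡ 0
count-none P s zero    none = refl
count-none P s (suc n) none rewrite none 0 z<s =
  count-none P (suc s) n (λ k k<n → trans (cong P (+-suc k s)) (none (suc k) (s<s k<n)))

strictly-between-multiples : ∀ r k j .{{_ : NonZero r}} → 0 < k → k < r → ¬ (r ∣ k + j * r)
strictly-between-multiples r k j 0<k k<r r∣ = <⇒≢ 0<k (begin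
  0               ≡⟨ sym (n∣m⇒m%n≡0 (k + j * r) r r∣) ⟩
  (k + j * r) % r ≡⟨ [m+kn]%n≡m%n k j r ⟩
  k % r           ≡⟨ m<n⇒m%n≡m k<r ⟩
  k               ∎)
  where open ≡-Reasoning

count-multiples-block : ∀ (P : ℕ → Bool) r' j → let r = suc r' in
  count (λ i → P i ∧ does (r ∣? i)) (suc (j * r)) r ≡ ⟦ P (suc j * r) ⟧
count-multiples-block P r' j = begin
  count F s (suc r')               ≡⟨ cong (count F s) (+-comm 1 r') ⟩
  count F s (r' + 1)               ≡⟨ count-+ F s r' 1 ⟩
  count F s r' + count F (s + r') 1 ≡⟨ cong₂ _+_ (count-none F s r' off-multiples) (cong (λ t → count F t 1) last) ⟩
  ⟦ F (suc j * r) ⟧ + 0             ≡⟨ +-identityʳ _ ⟩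
  ⟦ F (suc j * r) ⟧                 ≡⟨ cong ⟦_⟧ (cong (P (suc j * r) ∧_) (dec-true (r ∣? suc j * r) (n∣m*n (suc j)))) ⟩
  ⟦ P (suc j * r) ∧ true ⟧          ≡⟨ cong ⟦_⟧ (∧-identityʳ _) ⟩
  ⟦ P (suc j * r) ⟧                 ∎
  where
  open ≡-Reasoning
  r : ℕ
  r = suc r'
  F : ℕ → Bool
  F i = P i ∧ does (r ∣? i)
  s : ℕ
  s = suc (j * r)
  last : s + r' ≡ suc j * r
  last = cong suc (+-comm (j * r) r')
  off-multiples : ∀ k → k < r' → F (k + s) ≡ false
  off-multiples k k<r' = trans (cong (P (k + s) ∧_) (dec-false (r ∣? k + s)
      (λ r∣ → strictly-between-multiples r (suc k) j z<s (s<s k<r') (subst (r ∣_) (+-suc k (j * r)) r∣))))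
    (∧-zeroʳ (P (k + s)))

count-multiples : ∀ (P : ℕ → Bool) r' N j → let r = suc r' in
  count (λ i → P i ∧ does (r ∣? i)) (suc (j * r)) (N * r) ≡ count (λ t → P (t * r)) (suc j) N
count-multiples P r' zero    j = refl
count-multiples P r' (suc N) j = begin
  count F s (r + N * r)                 ≡⟨ count-+ F s r (N * r) ⟩
  count F s r + count F (s + r) (N * r) ≡⟨ cong₂ _+_ (count-multiples-block P r' j) (cong (λ t → count F t (N * r)) next) ⟩
  ⟦ P (suc j * r) ⟧ + count F (suc (suc j * r)) (N * r) ≡⟨ cong (⟦ P (suc j * r) ⟧ +_) (count-multiples P r' N (suc j)) ⟩
  ⟦ P (suc j * r) ⟧ + count (λ t → P (t * r)) (suc (suc j)) N ∎
  where
  open ≡-Reasoning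
  r : ℕ
  r = suc r'
  F : ℕ → Bool
  F i = P i ∧ does (r ∣? i)
  s : ℕ
  s = suc (j * r)
  next : s + r ≡ suc (suc j * r)
  next = cong suc (+-comm (j * r) r)

length-filter-consecutive : ∀ {P : ℕ → Set} (P? : Decidable P) (f : ℕ → ℕ) s n → (∀ i → f i ≡ s + i) →
  length (filter P? (applyUpTo f n)) ≡ count (does ∘ P?) s n
length-filter-consecutive P? f s zero    f≗ = refl
length-filter-consecutive P? f s (suc n) f≗ = begin
  length (filter P? (f 0 ∷ applyUpTo (f ∘ suc) n))       ≡⟨ length-filter-∷ (f 0) (applyUpTo (f ∘ suc) n) ⟩
  ⟦ does (P? (f 0)) ⟧ + length (filter P? (applyUpTo (f ∘ suc) n))
    ≡⟨ cong₂ (λ x l → ⟦ does (P? x) ⟧ + l) (trans (f≗ 0) (+-identityʳ s))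
             (length-filter-consecutive P? (f ∘ suc) (suc s) n (λ i → trans (f≗ (suc i)) (+-suc s i))) ⟩
  ⟦ does (P? s) ⟧ + count (does ∘ P?) (suc s) n          ∎
  where
  open ≡-Reasoning
  length-filter-∷ : ∀ x xs → length (filter P? (x ∷ xs)) ≡ ⟦ does (P? x) ⟧ + length (filter P? xs)
  length-filter-∷ x xs with does (P? x)
  ... | true  = refl
  ... | false = refl

coprimeTo : ℕ → ℕ → Bool
coprimeTo N i = does (coprime? i N)

φ≡count : ∀ N → φ N ≡ count (coprimeTo N) 1 N
φ≡count N = begin
  φ N                                                        ≡⟨ cong (length ∘ filter (λ k → gcd k N ≟ 1)) (map-upTo suc N) ⟩
  length (filter (λ k → gcd k N ≟ 1) (applyUpTo suc N))      ≡⟨ length-filter-consecutive (λ k → gcd k N ≟ 1) suc 1 N (λ i → refl) ⟩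
  count (λ k → does (gcd k N ≟ 1)) 1 N                       ≡⟨ count-cong (λ k → does-⇔ (mk⇔ gcd≡1⇒coprime coprime⇒gcd≡1) (gcd k N ≟ 1) (coprime? k N)) 1 N ⟩
  count (coprimeTo N) 1 N                                    ∎
  where open ≡-Reasoning

coprime-* : ∀ {a b c} → Coprime a b → Coprime a c → Coprime a (b * c)
coprime-* {a} {b} {c} a⊥b a⊥c {d} (d∣a , d∣bc) = a⊥c (d∣a , coprime-divisor d⊥b d∣bc)
  where
  d⊥b : Coprime d b
  d⊥b (e∣d , e∣b) = a⊥b (∣-trans e∣d d∣a , e∣b)

coprime-∣ : ∀ {a c M} → c ∣ M → Coprime a M → Coprime a c
coprime-∣ c∣M a⊥M (d∣a , d∣c) = a⊥M (d∣a , ∣-trans d∣c c∣M)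

coprime-∣ˡ : ∀ {a c M} → c ∣ M → Coprime M a → Coprime c a
coprime-∣ˡ c∣M M⊥a = Coprimality.sym (coprime-∣ c∣M (Coprimality.sym M⊥a))

prime-coprime : ∀ {r k} → Prime r → ¬ (r ∣ k) → Coprime k r
prime-coprime {r} pr r∤k {d} (d∣k , d∣r) with prime⇒irreducible pr d∣r
... | inj₁ d≡1 = d≡1
... | inj₂ refl = ⊥-elim (r∤k d∣k)

coprimeTo-periodic : ∀ N i → coprimeTo N (i + N) ≡ coprimeTo N i
coprimeTo-periodic N i = does-⇔ (mk⇔ reduce shift) (coprime? (i + N) N) (coprime? i N)
  where
  reduce : Coprime (i + N) N → Coprime i N
  reduce c (d∣i , d∣N) = c (∣m∣n⇒∣m+n d∣i d∣N , d∣N)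
  shift : Coprime i N → Coprime (i + N) N
  shift c = subst (λ x → Coprime x N) (+-comm N i) (Coprimality.coprime-+ c)

coprimeTo-scaled : ∀ {r N} → Coprime r N → ∀ t → coprimeTo N (t * r) ≡ coprimeTo N t
coprimeTo-scaled {r} {N} r⊥N t = does-⇔ (mk⇔ (coprime-∣ˡ (m∣m*n r)) unscale) (coprime? (t * r) N) (coprime? t N)
  where
  unscale : Coprime t N → Coprime (t * r) N
  unscale c = Coprimality.sym (coprime-* (Coprimality.sym c) (Coprimality.sym r⊥N))

coprimeTo-divisor-multiple : ∀ {r N} → r ∣ N → ∀ i → coprimeTo (r * N) i ≡ coprimeTo N i
coprimeTo-divisor-multiple {r} {N} r∣N i = does-⇔ (mk⇔ (coprime-∣ (n∣m*n r)) (λ c → coprime-* (coprime-∣ r∣N c) c))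
                                                   (coprime? i (r * N)) (coprime? i N)

coprimeTo-prime-multiple : ∀ {r N} → Prime r → ∀ i → coprimeTo (r * N) i ≡ coprimeTo N i ∧ not (does (r ∣? i))
coprimeTo-prime-multiple {r} {N} pr i = does-⇔ (mk⇔ split (λ (c , r∤i) → coprime-* (prime-coprime pr r∤i) c))
                                                (coprime? i (r * N)) (coprime? i N ×-dec ¬? (r ∣? i))
  where
  split : Coprime i (r * N) → Coprime i N × ¬ (r ∣ i)
  split c = coprime-∣ (n∣m*n r) c , λ r∣i → nonTrivial⇒≢1 {{prime⇒nonTrivial pr}} (c (r∣i , m∣m*n N))

φ-*-divisor : ∀ r N → r ∣ N → φ (r * N) ≡ r * φ N
φ-*-divisor r N r∣N = begin
  φ (r * N)                           ≡⟨ φ≡count (r * N) ⟩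
  count (coprimeTo (r * N)) 1 (r * N) ≡⟨ count-cong (coprimeTo-divisor-multiple r∣N) 1 (r * N) ⟩
  count (coprimeTo N) 1 (r * N)       ≡⟨ count-periodic (coprimeTo N) N (coprimeTo-periodic N) r 1 ⟩
  r * count (coprimeTo N) 1 N         ≡⟨ cong (r *_) (sym (φ≡count N)) ⟩
  r * φ N                             ∎
  where open ≡-Reasoning

-- Multiplying N by a prime r not dividing it multiplies φ N by r - 1: the residues in [1, r N]
-- coprime to N (r φ N of them) are the r-multiples t r with t coprime to N (φ N of them) and the
-- residues coprime to r N.
φ-*-prime : ∀ r' N → Prime (suc r') → ¬ (suc r' ∣ N) → φ (suc r' * N) ≡ r' * φ N
φ-*-prime r' N pr r∤N = sym (+-cancelˡ-≡ (φ N) (r' * φ N) (φ (r * N)) (begin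
  r * φ N                                                         ≡⟨ cong (r *_) (φ≡count N) ⟩
  r * count (coprimeTo N) 1 N                                     ≡⟨ sym (count-periodic (coprimeTo N) N (coprimeTo-periodic N) r 1) ⟩
  count (coprimeTo N) 1 (r * N)                                   ≡⟨ count-∧-split (coprimeTo N) (λ i → does (r ∣? i)) 1 (r * N) ⟩
  count (λ i → coprimeTo N i ∧ does (r ∣? i)) 1 (r * N)
    + count (λ i → coprimeTo N i ∧ not (does (r ∣? i))) 1 (r * N) ≡⟨ cong₂ _+_ multiples non-multiples ⟩
  φ N + φ (r * N)                                                 ∎))
  where
  open ≡-Reasoning
  r : ℕ
  r = suc r'
  multiples : count (λ i → coprimeTo N i ∧ does (r ∣? i)) 1 (r * N) ≡ φ N
  multiples = begin
    count (λ i → coprimeTo N i ∧ does (r ∣? i)) 1 (r * N) ≡⟨ cong (count _ 1) (*-comm r N) ⟩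
    count (λ i → coprimeTo N i ∧ does (r ∣? i)) 1 (N * r) ≡⟨ count-multiples (coprimeTo N) r' N 0 ⟩
    count (λ t → coprimeTo N (t * r)) 1 N                 ≡⟨ count-cong (coprimeTo-scaled (Coprimality.sym (prime-coprime pr r∤N))) 1 N ⟩
    count (coprimeTo N) 1 N                               ≡⟨ sym (φ≡count N) ⟩
    φ N                                                   ∎
  non-multiples : count (λ i → coprimeTo N i ∧ not (does (r ∣? i))) 1 (r * N) ≡ φ (r * N)
  non-multiples = begin
    count (λ i → coprimeTo N i ∧ not (does (r ∣? i))) 1 (r * N) ≡⟨ count-cong (λ i → sym (coprimeTo-prime-multiple pr i)) 1 (r * N) ⟩
    count (coprimeTo (r * N)) 1 (r * N)                         ≡⟨ sym (φ≡count (r * N)) ⟩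
    φ (r * N)                                                   ∎

square∣⇒∣φ : ∀ q N → q * q ∣ N → q ∣ φ N
square∣⇒∣φ q N (divides t N≡tqq) = divides (φ (t * q)) (begin
  φ N             ≡⟨ cong φ N≡tqq ⟩
  φ (t * (q * q)) ≡⟨ cong φ (sym (trans (*-comm q (t * q)) (*-assoc t q q))) ⟩
  φ (q * (t * q)) ≡⟨ φ-*-divisor q (t * q) (n∣m*n t) ⟩
  q * φ (t * q) ≡⟨ *-comm q (φ (t * q)) ⟩
  φ (t * q) * q ∎)
  where open ≡-Reasoning

prime≥2 : ∀ {q} → Prime q → 2 ≤ q
prime≥2 {suc (suc q)} _ = s≤s (s≤s z≤n)

prime∣!⇒≤ : ∀ {q} → Prime q → ∀ n → q ∣ n ! → q ≤ n
prime∣!⇒≤ pq zero    q∣1 = ⊥-elim (<⇒≢ (prime≥2 pq) (sym (∣1⇒≡1 q∣1)))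
prime∣!⇒≤ pq (suc n) q∣n+1! with euclidsLemma (suc n) (n !) pq q∣n+1!
... | inj₁ q∣n+1 = ∣⇒≤ q∣n+1
... | inj₂ q∣n!  = m≤n⇒m≤1+n (prime∣!⇒≤ pq n q∣n!)

prime∣^⇒∣ : ∀ {q} → Prime q → ∀ x m → q ∣ x ^ m → q ∣ x
prime∣^⇒∣ pq x zero    q∣1 = ⊥-elim (<⇒≢ (prime≥2 pq) (sym (∣1⇒≡1 q∣1)))
prime∣^⇒∣ pq x (suc m) q∣x^m+1 with euclidsLemma x (x ^ m) pq q∣x^m+1
... | inj₁ q∣x   = q∣x
... | inj₂ q∣x^m = prime∣^⇒∣ pq x m q∣x^m

PrimeFactorsAtMost : ℕ → ℕ → Set
PrimeFactorsAtMost k N = ∀ {q} → Prime q → q ∣ N → q ≤ k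

bound-∣ : ∀ {k M N} → M ∣ N → PrimeFactorsAtMost k N → PrimeFactorsAtMost k M
bound-∣ M∣N bound pq q∣M = bound pq (∣-trans q∣M M∣N)

bound-pred : ∀ {k N} → PrimeFactorsAtMost (suc k) N → (Prime (suc k) → ¬ (suc k ∣ N)) → PrimeFactorsAtMost k N
bound-pred {k} bound k+1∤N {q} pq q∣N with m≤n⇒m<n∨m≡n (bound pq q∣N)
... | inj₁ q<k+1 = s≤s⁻¹ q<k+1
... | inj₂ refl  = ⊥-elim (k+1∤N pq q∣N)

bound-one : ∀ N → .{{NonZero N}} → PrimeFactorsAtMost 1 N → N ≡ 1
bound-one N bound with factorise N
... | record { factors = [] ; isFactorisation = N≡1 } = N≡1
... | record { factors = q ∷ qs ; isFactorisation = N≡∏ ; factorsPrime = pq ∷ _ } =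
  ⊥-elim (<⇒≱ (prime≥2 pq) (bound pq (divides (product qs) (trans N≡∏ (*-comm q (product qs))))))

primePred : ℕ → ℕ
primePred k = if does (prime? (suc k)) then k else 1

primePred-prime : ∀ k → Prime (suc k) → primePred k ≡ k
primePred-prime k pr = cong (if_then k else 1) (dec-true (prime? (suc k)) pr)

primePred-composite : ∀ k → ¬ Prime (suc k) → primePred k ≡ 1
primePred-composite k ¬pr = cong (if_then k else 1) (dec-false (prime? (suc k)) ¬pr)

-- predProd j = ∏ { q - 1 ∣ q ≤ j + 1 prime } = ∏_{k=1}^{j} primePred k.
predProd : ℕ → ℕ
predProd zero    = 1
predProd (suc j) = predProd j * primePred (suc j)

-- Adding the prime r = j + 2 to the allowed prime factors: induction on N,
-- peeling off one factor r at a time with the two multiplicativity rules of φ.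
φ∣-prime-layer : ∀ j → Prime (suc (suc j)) →
  (∀ M → .{{NonZero M}} → PrimeFactorsAtMost (suc j) M → φ M ∣ M * predProd j) →
  ∀ N → .{{NonZero N}} → PrimeFactorsAtMost (suc (suc j)) N → φ N ∣ N * (predProd j * suc j)
φ∣-prime-layer j pr below = <-rec Goal layer
  where
  r P : ℕ
  r = suc (suc j)
  P = predProd j
  Goal : ℕ → Set
  Goal N = .{{NonZero N}} → PrimeFactorsAtMost r N → φ N ∣ N * (P * suc j)
  multiple : ∀ M → .{{NonZero M}} → Goal M → PrimeFactorsAtMost r (r * M) → φ (r * M) ∣ r * M * (P * suc j)
  multiple M ih bound with r ∣? M
  ... | yes r∣M = subst₂ _∣_ (sym (φ-*-divisor r M r∣M)) (sym (*-assoc r M (P * suc j)))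
                    (*-monoʳ-∣ r (ih (bound-∣ (n∣m*n r) bound)))
  ... | no r∤M = subst₂ _∣_ (sym (φ-*-prime (suc j) M pr r∤M)) (regroup r (suc j) M P)
                   (∣n⇒∣m*n r (*-monoʳ-∣ (suc j) (below M (bound-pred (bound-∣ (n∣m*n r) bound) (λ _ → r∤M)))))
    where
    regroup : ∀ r s M P → r * (s * (M * P)) ≡ r * M * (P * s)
    regroup = solve-∀
  layer : ∀ N → (∀ {K} → K < N → Goal K) → Goal N
  layer N rec bound with r ∣? N
  ... | no r∤N = ∣-trans (below N (bound-pred bound (λ _ → r∤N))) (*-monoʳ-∣ N (m∣m*n (suc j)))
  ... | yes (divides M refl) = subst (λ K → φ K ∣ K * (P * suc j)) (*-comm r M)
          (multiple M (rec (m<m*n M r (s≤s (s≤s z≤n)))) (subst (PrimeFactorsAtMost r) (*-comm M r) bound))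
    where
    instance
      M≢0 : NonZero M
      M≢0 = m*n≢0⇒m≢0 M

φ∣*predProd : ∀ j N → .{{NonZero N}} → PrimeFactorsAtMost (suc j) N → φ N ∣ N * predProd j
φ∣*predProd zero    N bound = subst (λ K → φ K ∣ K * 1) (sym (bound-one N bound)) ∣-refl
φ∣*predProd (suc j) N bound with prime? (suc (suc j))
... | yes pr = subst (λ x → φ N ∣ N * (predProd j * x)) (sym (primePred-prime (suc j) pr))
                 (φ∣-prime-layer j pr (φ∣*predProd j) N bound)
... | no ¬pr = subst (λ x → φ N ∣ N * x) (sym (trans (cong (predProd j *_) (primePred-composite (suc j) ¬pr)) (*-identityʳ _)))
                 (φ∣*predProd j N (bound-pred bound (λ pr → ⊥-elim (¬pr pr))))

primePred-k-or-1 : ∀ k → primePred k ≡ k ⊎ primePred k ≡ 1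
primePred-k-or-1 k with does (prime? (suc k))
... | true  = inj₁ refl
... | false = inj₂ refl

primePred∣ : ∀ k → primePred k ∣ k
primePred∣ k with primePred-k-or-1 k
... | inj₁ e = subst (_∣ k) (sym e) ∣-refl
... | inj₂ e = subst (_∣ k) (sym e) (1∣ k)

primePred-nonZero : ∀ k → NonZero (primePred (suc k))
primePred-nonZero k with primePred-k-or-1 (suc k)
... | inj₁ e = subst NonZero (sym e) _
... | inj₂ e = subst NonZero (sym e) _

predProd-nonZero : ∀ j → NonZero (predProd j)
predProd-nonZero zero    = _
predProd-nonZero (suc j) = m*n≢0 (predProd j) (primePred (suc j)) {{predProd-nonZero j}} {{primePred-nonZero j}}

predProd∣! : ∀ j → predProd j ∣ j !
predProd∣! zero    = ∣-refl
predProd∣! (suc j) = subst (predProd (suc j) ∣_) (*-comm (j !) (suc j)) (*-pres-∣ (predProd∣! j) (primePred∣ (suc j)))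

predProd*next∣! : ∀ j → predProd j * suc j ∣ suc j !
predProd*next∣! j = subst (predProd j * suc j ∣_) (*-comm (j !) (suc j)) (*-monoˡ-∣ (suc j) (predProd∣! j))

predProd-gap : ∀ j k → 0 < k → k ≤ j → primePred k ≡ 1 → predProd j * k ∣ j !
predProd-gap zero    k 0<k k≤0   skip = ⊥-elim (<⇒≱ 0<k k≤0)
predProd-gap (suc j) k 0<k k≤j+1 skip with m≤n⇒m<n∨m≡n k≤j+1
... | inj₁ k<j+1 = subst₂ _∣_ (swap (predProd j) k (primePred (suc j))) (*-comm (j !) (suc j))
                     (*-pres-∣ (predProd-gap j k 0<k (s≤s⁻¹ k<j+1) skip) (primePred∣ (suc j)))
  where
  swap : ∀ a b c → a * b * c ≡ a * c * b
  swap = solve-∀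
... | inj₂ refl  = subst₂ _∣_ (cong (λ x → predProd j * x * suc j) (sym skip)) (*-comm (j !) (suc j))
                     (*-monoˡ-∣ (suc j) (subst (_∣ j !) (sym (*-identityʳ (predProd j))) (predProd∣! j)))

p∣c*N : ∀ {p c b N D M} .{{_ : NonZero D}} → c * φ N ≡ b * M → φ N ∣ N * D → D * p ∣ M → p ∣ c * N
p∣c*N {p} {c} {b} {N} {D} {M} eq (divides s ND≡sφ) (divides t M≡tDp) =
  divides (s * b * t) (*-cancelʳ-≡ (c * N) (s * b * t * p) D (begin
    c * N * D             ≡⟨ *-assoc c N D ⟩
    c * (N * D)           ≡⟨ cong (c *_) ND≡sφ ⟩
    c * (s * φ N)         ≡⟨ swap c s (φ N) ⟩
    s * (c * φ N)         ≡⟨ cong (s *_) eq ⟩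
    s * (b * M)           ≡⟨ cong (λ x → s * (b * x)) M≡tDp ⟩
    s * (b * (t * (D * p))) ≡⟨ regroup s b t D p ⟩
    s * b * t * p * D     ∎))
  where
  open ≡-Reasoning
  swap : ∀ c s x → c * (s * x) ≡ s * (c * x)
  swap = solve-∀
  regroup : ∀ s b t D p → s * (b * (t * (D * p))) ≡ s * b * t * p * D
  regroup = solve-∀

even-or-odd : ∀ n → 2 ∣ n ⊎ 2 ∣ suc n
even-or-odd zero = inj₁ (divides 0 refl)
even-or-odd (suc n) with even-or-odd n
... | inj₁ 2∣n  = inj₂ (∣m∣n⇒∣m+n (∣-refl {2}) 2∣n)
... | inj₂ 2∣n+1 = inj₁ 2∣n+1

small-odd : ∀ m → 2 ≤ m → m ≤ 7 → 2 ∣ suc m → m ≡ 3 ⊎ m ≡ 5 ⊎ m ≡ 7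
small-odd 0 () _ _
small-odd 1 (s≤s ()) _ _
small-odd 2 _ _ 2∣3 = ⊥-elim (from-no (2 ∣? 3) 2∣3)
small-odd 3 _ _ _   = inj₁ refl
small-odd 4 _ _ 2∣5 = ⊥-elim (from-no (2 ∣? 5) 2∣5)
small-odd 5 _ _ _   = inj₂ (inj₁ refl)
small-odd 6 _ _ 2∣7 = ⊥-elim (from-no (2 ∣? 7) 2∣7)
small-odd 7 _ _ _   = inj₂ (inj₂ refl)
small-odd (suc (suc (suc (suc (suc (suc (suc (suc k)))))))) _ m≤7 _ = ⊥-elim (<⇒≱ (m≤m+n 8 k) m≤7)

factorial-room : ∀ n {p} → Prime p → p ≤ suc n → ¬ (predProd n * p ∣ suc n !) →
  p ≡ 2 × (suc n ≡ 3 ⊎ suc n ≡ 5 ⊎ suc n ≡ 7)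
factorial-room n {p} pp p≤n+1 no-room = by-parity (even-or-odd p)
  where
  gap : ∀ k → 0 < k → k ≤ suc n → primePred k ≡ 1 → predProd n * k ∣ suc n !
  gap k 0<k k≤n+1 skip = ∣-trans (*-monoˡ-∣ k (m∣m*n {predProd n} (primePred (suc n)))) (predProd-gap (suc n) k 0<k k≤n+1 skip)
  -- For odd p, p + 1 is even and > 2, hence a skipped factor.
  odd-p+1-composite : 2 ∣ suc p → ¬ Prime (suc p)
  odd-p+1-composite 2∣p+1 pr with prime⇒irreducible pr 2∣p+1
  ... | inj₁ ()
  ... | inj₂ 2≡p+1 = <⇒≢ (prime≥2 pp) (suc-injective 2≡p+1)
  -- For p = 2 and n + 1 odd, the extra factor 2 comes from the skipped factor 8 (9 is not prime)
  -- as soon as n + 1 ≥ 8; below that, n + 1 ∈ {3, 5, 7}.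
  by-size : p ≡ 2 → 2 ∣ suc (suc n) → suc n ≡ 3 ⊎ suc n ≡ 5 ⊎ suc n ≡ 7
  by-size p≡2 2∣n+2 with 8 ≤? suc n
  ... | yes 8≤n+1 = ⊥-elim (no-room (subst (λ q → predProd n * q ∣ suc n !) (sym p≡2)
                      (∣-trans (*-monoʳ-∣ (predProd n) (divides 4 refl)) (gap 8 z<s 8≤n+1 (primePred-composite 8 9-composite)))))
    where
    9-composite : ¬ Prime 9
    9-composite pr with prime⇒irreducible pr {3} (divides 3 refl)
    ... | inj₁ ()
    ... | inj₂ ()
  ... | no 8≰n+1 = small-odd (suc n) (subst (_≤ suc n) p≡2 p≤n+1) (s≤s⁻¹ (≰⇒> 8≰n+1)) 2∣n+2
  -- Odd p is itself a skipped factor; for p = 2 and n + 1 even, the factor n + 1 supplies the 2.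
  by-parity : 2 ∣ p ⊎ 2 ∣ suc p → p ≡ 2 × (suc n ≡ 3 ⊎ suc n ≡ 5 ⊎ suc n ≡ 7)
  by-parity (inj₂ 2∣p+1) = ⊥-elim (no-room (gap p (<-trans z<s (prime≥2 pp)) p≤n+1 (primePred-composite p (odd-p+1-composite 2∣p+1))))
  by-parity (inj₁ 2∣p) with prime⇒irreducible pp 2∣p
  ... | inj₁ ()
  ... | inj₂ refl with even-or-odd (suc n)
  ...   | inj₁ 2∣n+1 = ⊥-elim (no-room (∣-trans (*-monoʳ-∣ (predProd n) 2∣n+1) (predProd*next∣! n)))
  ...   | inj₂ 2∣n+2 = refl , by-size refl 2∣n+2

large-prime-factor-bound : ∀ {x n m a b c q} → 2 ≤ m → 0 < b → c * φ (a * x ^ m) ≡ b * n ! →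
  Prime q → b < q → q ∣ x → q ≤ n
large-prime-factor-bound {m = 1} (s≤s ()) _ _ _ _ _
large-prime-factor-bound {x} {n} {suc (suc m)} {a} {b} {c} {q} _ 0<b eq pq b<q q∣x
  with euclidsLemma b (n !) pq (subst (q ∣_) eq (∣n⇒∣m*n c (square∣⇒∣φ q (a * x ^ suc (suc m)) q²∣N)))
  where
  q²∣N : q * q ∣ a * x ^ suc (suc m)
  q²∣N = ∣n⇒∣m*n a (*-pres-∣ q∣x (∣m⇒∣m*n (x ^ m) q∣x))
... | inj₁ q∣b  = ⊥-elim (>⇒∤ {{>-nonZero 0<b}} b<q q∣b)
... | inj₂ q∣n! = prime∣!⇒≤ pq n q∣n!

exceptional-prime : ∀ {p c b N} n → .{{_ : NonZero N}} → Prime p → ¬ (p ∣ c) → ¬ (p ∣ N) →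
  PrimeFactorsAtMost n N → c * φ N ≡ b * n ! → p ≤ n → p ≡ 2 × (n ≡ 3 ⊎ n ≡ 5 ⊎ n ≡ 7)
exceptional-prime zero    pp _ _ _ _ p≤0 = ⊥-elim (<⇒≱ z<s (≤-trans (prime≥2 pp) p≤0))
exceptional-prime {p} {c} {b} {N} (suc n) pp p∤c p∤N bound eq p≤n+1 = factorial-room n pp p≤n+1 no-room
  where
  no-room : ¬ (predProd n * p ∣ suc n !)
  no-room room with euclidsLemma c N pp (p∣c*N {c = c} {b} {N} {{predProd-nonZero n}} eq (φ∣*predProd n N bound) room)
  ... | inj₁ p∣c = p∤c p∣c
  ... | inj₂ p∣N = p∤N p∣N

proposition1 : ∀ (x n m a b c p : ℕ) → 1 ≤ x → 1 ≤ n → 1 ≤ m → 1 ≤ a → 1 ≤ b → 1 ≤ c →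
    m ≥ 2 → c * φ (a * x ^ m) ≡ b * (n !) →
    Prime p → a < p → b < p → c < p →
    (p ∣ x → p ≤ n) ×
    (p ≤ n → ¬ (p ∣ x) → p ≡ 2 × (n ≡ 3 ⊎ n ≡ 5 ⊎ n ≡ 7))
proposition1 x n m a b c p 1≤x _ _ 1≤a 1≤b 1≤c m≥2 eq pp a<p b<p c<p = bound pp b<p , converse
  where
  instance
    N≢0 : NonZero (a * x ^ m)
    N≢0 = m*n≢0 a (x ^ m) {{>-nonZero 1≤a}} {{m^n≢0 x m {{>-nonZero 1≤x}}}}
  bound : ∀ {q} → Prime q → b < q → q ∣ x → q ≤ n
  bound = large-prime-factor-bound {a = a} {b} {c} m≥2 1≤b eq
  -- Prime factors of a are below p; those of x are below p or handled by the first part.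
  N-bound : p ≤ n → PrimeFactorsAtMost n (a * x ^ m)
  N-bound p≤n {q} pq q∣N with euclidsLemma a (x ^ m) pq q∣N | q ≤? p
  ... | inj₁ q∣a   | _       = ≤-trans (∣⇒≤ {{>-nonZero 1≤a}} q∣a) (≤-trans (<⇒≤ a<p) p≤n)
  ... | inj₂ _     | yes q≤p = ≤-trans q≤p p≤n
  ... | inj₂ q∣x^m | no q≰p  = bound pq (<-trans b<p (≰⇒> q≰p)) (prime∣^⇒∣ pq x m q∣x^m)
  p∤N : ¬ (p ∣ x) → ¬ (p ∣ a * x ^ m)
  p∤N p∤x p∣N with euclidsLemma a (x ^ m) pp p∣N
  ... | inj₁ p∣a   = >⇒∤ {{>-nonZero 1≤a}} a<p p∣a
  ... | inj₂ p∣x^m = p∤x (prime∣^⇒∣ pp x m p∣x^m)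
  converse : p ≤ n → ¬ (p ∣ x) → p ≡ 2 × (n ≡ 3 ⊎ n ≡ 5 ⊎ n ≡ 7)
  converse p≤n p∤x = exceptional-prime {c = c} {b} n pp (>⇒∤ {{>-nonZero 1≤c}} c<p) (p∤N p∤x) (N-bound p≤n) eq p≤n
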